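{- Let $G$ be a finite simple undirected graph of order $n$ and clique number $\omega(G)$. Then $$\chi_o^+(G)\ge\chi_o^+(K_{\omega(G)})\ge 2^{\frac{\omega(G)-1}{2}}$$ and $$\chi_o^+(G)\le\chi_o^+(K_n)\le \begin{cases} n\,2^{\frac{n-1}{2}} & \text{if $n$ is odd,}\\ \frac{3}{2\sqrt{2}}\,n\,2^{\frac{n-1}{2}} & \text{if $n$ is even.}\end{cases}$$
   Context: All graphs are finite and simple. An oriented graph is a digraph with no loops, no multiple arcs and no pair of opposite arcs; an orientation of an undirected graph $G$ is obtained by giving each edge one of its two directions. A homomorphism from an oriented graph $\vec G$ to an oriented graph $\vec T$ is a map $V(\vec G)\to V(\vec T)$ sending every arc to an arc. The upper oriented chromatic number $\chi_o^+(G)$ of an undirected graph $G$ is the smallest order of an oriented graph $\vec T$ such that every orientation of $G$ admits a homomorphism to $\vec T$. $K_m$ is the complete graph on $m$ vertices, and $\omega(G)$ is the maximum order of a complete subgraph of $G$. -}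

module Defs where

open import Data.Nat using (ℕ; _≤_)
open import Data.Fin using (Fin; _≟_)
open import Data.Bool using (Bool; true; false; not)
open import Data.Product using (Σ; _×_; ∃)
open import Data.Sum using (_⊎_)
open import Data.Empty using (⊥)
open import Relation.Nullary using (¬_; yes; no)
open import Relation.Nullary.Decidable using (⌊_⌋)
open import Relation.Binary.PropositionalEquality using (_≡_; refl; sym)
open import Function.Definitions using (Injective)

record Graph (n : ℕ) : Set where
  field
    adj     : Fin n → Fin n → Bool
    adj-sym : ∀ u v → adj u v ≡ adj v u
    adj-irr : ∀ u → adj u u ≡ false
open Graph public

record OrientedGraph (m : ℕ) : Set where
  field
    arc       : Fin m → Fin m → Bool
    arc-irr   : ∀ u → arc u u ≡ false
    arc-asym  : ∀ u v → arc u v ≡ true → arc v u ≡ false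
open OrientedGraph public

record Orientation {n : ℕ} (G : Graph n) : Set where
  field
    dir       : Fin n → Fin n → Bool
    dir-edge  : ∀ u v → dir u v ≡ true → adj G u v ≡ true
    dir-total : ∀ u v → adj G u v ≡ true → dir u v ≡ true ⊎ dir v u ≡ true
    dir-asym  : ∀ u v → dir u v ≡ true → dir v u ≡ false
open Orientation public

IsHom : ∀ {n m} {G : Graph n} → Orientation G → OrientedGraph m → (Fin n → Fin m) → Set
IsHom O T f = ∀ u v → dir O u v ≡ true → arc T (f u) (f v) ≡ true

Universal : ∀ {n} → Graph n → ℕ → Set
Universal {n} G m =
  Σ (OrientedGraph m) λ T → (O : Orientation G) → Σ (Fin n → Fin m) λ f → IsHom O T f

IsUpperOrientedChromaticNumber : ∀ {n} → Graph n → ℕ → Set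
IsUpperOrientedChromaticNumber G k = Universal G k × (∀ m → Universal G m → k ≤ m)

HasClique : ∀ {n} → Graph n → ℕ → Set
HasClique {n} G w =
  Σ (Fin w → Fin n) λ f → Injective _≡_ _≡_ f × (∀ i j → ¬ (i ≡ j) → adj G (f i) (f j) ≡ true)

IsCliqueNumber : ∀ {n} → Graph n → ℕ → Set
IsCliqueNumber G w = HasClique G w × (∀ k → HasClique G k → k ≤ w)

K-adj : ∀ {m} → Fin m → Fin m → Bool
K-adj i j = not ⌊ i ≟ j ⌋

K-sym : ∀ {m} (i j : Fin m) → K-adj i j ≡ K-adj j i
K-sym i j with i ≟ j | j ≟ i
... | yes _ | yes _ = refl
... | yes p | no q = Data.Empty.⊥-elim (q (sym p))
  where import Data.Empty
... | no q | yes p = Data.Empty.⊥-elim (q (sym p))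
  where import Data.Empty
... | no _ | no _ = refl

K-irr : ∀ {m} (i : Fin m) → K-adj i i ≡ false
K-irr i with i ≟ i
... | yes _ = refl
... | no q = Data.Empty.⊥-elim (q refl)
  where import Data.Empty

K : (m : ℕ) → Graph m
K m = record { adj = K-adj ; adj-sym = K-sym ; adj-irr = K-irr }

-- Every orientation of a subgraph H of G extends to an orientation of G (transport it along
-- the embedding and orient all remaining edges by vertex index), so an oriented graph receiving
-- every orientation of G receives every orientation of H.  With G ⊆ K n and K ω ⊆ G this gives
-- χ(K ω) ≤ χ(G) ≤ χ(K n); the minima exist because universality of a given order is decidable
-- by exhaustive search.
--
-- Lower bound: a target of order k for all tournaments on w vertices receives each tournament by a
-- map Fin w → Fin k that determines it.  A Bool matrix on Fin w is determined by the two
-- tournaments read off its upper and lower triangle together with its diagonal, so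
-- 2^(w·w) ≤ 2^w · (k^w)², that is 2^(w-1) ≤ k².
--
-- Upper bound: put the vertices of K n on the cycle ℤ/n and let each vertex u record, as a bit
-- string, the orientation of its arcs to the next j vertices ahead of it.  Every pair is recorded
-- by an endpoint from which the other lies at most halfway round, so the pairs (u, bits), with
-- arcs read off from the recording endpoint, form a universal target: of order n·2^j for
-- n = 2j+1, and of order j·2^j + j·2^(j-1) for n = 2j, where the vertices of the upper half never
-- record a pair at distance exactly j and so need one bit fewer.

module Submission where

open import Defs
open import Data.Bool using (Bool; true; false; not; _∧_; _∨_)
import Data.Bool.Properties as Boolₚ
open Boolₚ using (not-injective; ∧-zeroʳ; ∧-conicalˡ; ∧-conicalʳ)
open import Data.Empty using (⊥-elim)
open import Data.Fin using (Fin; zero; suc; toℕ; fromℕ<; _≟_; combine; remQuot; funToFin; finToFun; splitAt; _↑ˡ_; _↑ʳ_)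
open import Data.Fin.Properties
  using ( <-cmp; <⇒≢; any?; all?; 2↔Bool; toℕ-injective; toℕ-fromℕ<; toℕ<n; toℕ-↑ʳ; combine-injective
        ; remQuot-combine; finToFun-funToFin; funToFin-finToFin; injective⇒≤
        ; splitAt-↑ˡ; splitAt-↑ʳ; splitAt⁻¹-↑ˡ; splitAt⁻¹-↑ʳ )
open import Data.Nat using (ℕ; zero; suc; _≤_; _<_; _*_; _+_; _^_; _∸_; NonZero; _≤?_; _<?_; s≤s; s≤s⁻¹)
open import Data.Nat.DivMod using (_mod_; m<n⇒m%n≡m; [m+n]%n≡m%n)
open import Data.Nat.Induction using (<-rec)
open import Data.Nat.Properties
  using ( ≤-refl; ≤-trans; ≤-reflexive; <⇒≤; <⇒≱; ≰⇒>; ≮⇒≥; <-≤-trans; 1+n≰n; n≤1+n; m≤m+n; m≤n+m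
        ; +-suc; +-comm; +-assoc; +-identityʳ; +-cancelˡ-≡; +-cancelˡ-<; +-mono-≤; +-monoˡ-≤; m+[n∸m]≡n
        ; *-monoʳ-≤; *-cancelˡ-≤; [m*n]*[o*p]≡[m*o]*[n*p]; ^-monoˡ-<; m^n≢0; module ≤-Reasoning )
open import Data.Nat.Tactic.RingSolver using (solve-∀)
open import Data.Product using (Σ; _×_; _,_; proj₁; proj₂; ∃; map; map₂)
open import Data.Sum using (_⊎_; inj₁; inj₂; [_,_]′)
import Data.Sum as Sum
open import Function using (id; _∘_; const; flip; Inverse)
open import Function.Definitions using (Injective)
open import Relation.Binary using (tri<; tri≈; tri>)
open import Relation.Binary.PropositionalEquality
  using (_≡_; _≢_; _≗_; refl; sym; trans; cong; cong₂; subst; subst₂; module ≡-Reasoning)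
open import Relation.Nullary using (Dec; yes; no; contradiction; map′; _×-dec_; _→-dec_; _⊎-dec_)
open import Relation.Unary using (Decidable)

open Inverse 2↔Bool using ()
  renaming (to to toBool; from to fromBool; strictlyInverseˡ to toBool-fromBool; strictlyInverseʳ to fromBool-toBool)

K-adj⇒≢ : ∀ {m} {u v : Fin m} → K-adj u v ≡ true → u ≢ v
K-adj⇒≢ {u = u} uv refl = contradiction (trans (sym uv) (K-irr u)) λ ()

≢⇒K-adj : ∀ {m} {u v : Fin m} → u ≢ v → K-adj u v ≡ true
≢⇒K-adj {u = u} {v} u≢v with u ≟ v
... | yes u≡v = contradiction u≡v u≢v
... | no _ = refl

adj⇒≢ : ∀ {n} (G : Graph n) {u v} → adj G u v ≡ true → u ≢ v
adj⇒≢ G {u} uv refl = contradiction (trans (sym uv) (adj-irr G u)) λ ()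

not-dir-flip : ∀ {n} (O : Orientation (K n)) {u v} → u ≢ v → not (dir O v u) ≡ dir O u v
not-dir-flip O {u} {v} u≢v with dir O u v in uv
... | true = cong not (dir-asym O u v uv)
... | false with dir-total O u v (≢⇒K-adj u≢v)
...   | inj₁ uv′ = contradiction (trans (sym uv′) uv) λ ()
...   | inj₂ vu = cong not vu

tournament-hom-arc : ∀ {n m} (O : Orientation (K n)) (T : OrientedGraph m) {f} → IsHom O T f →
                     ∀ u v → dir O u v ≡ arc T (f u) (f v)
tournament-hom-arc O T {f} hom u v with dir O u v in uv
... | true = sym (hom u v uv)
... | false with u ≟ v
...   | yes refl = sym (arc-irr T (f u))
...   | no u≢v = sym (arc-asym T (f v) (f u) (hom v u (not-injective (trans (not-dir-flip O u≢v) uv))))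

true⊎not : ∀ b → b ≡ true ⊎ not b ≡ true
true⊎not true = inj₁ refl
true⊎not false = inj₂ refl

module ByKey {A : Set} {n : ℕ} (key : A → Fin n) (M : A → A → Bool) where

  byKey : A → A → Bool
  byKey x y with <-cmp (key x) (key y)
  ... | tri< _ _ _ = M x y
  ... | tri≈ _ _ _ = false
  ... | tri> _ _ _ = not (M y x)

  byKey-< : ∀ {x y} → toℕ (key x) < toℕ (key y) → byKey x y ≡ M x y
  byKey-< {x} {y} x<y with <-cmp (key x) (key y)
  ... | tri< _ _ _ = refl
  ... | tri≈ x≮y _ _ = contradiction x<y x≮y
  ... | tri> x≮y _ _ = contradiction x<y x≮y

  byKey-> : ∀ {x y} → toℕ (key y) < toℕ (key x) → byKey x y ≡ not (M y x)
  byKey-> {x} {y} y<x with <-cmp (key x) (key y)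
  ... | tri< _ _ y≮x = contradiction y<x y≮x
  ... | tri≈ _ _ y≮x = contradiction y<x y≮x
  ... | tri> _ _ _ = refl

  byKey-≡ : ∀ {x y} → key x ≡ key y → byKey x y ≡ false
  byKey-≡ {x} {y} x≡y with <-cmp (key x) (key y)
  ... | tri< _ x≢y _ = contradiction x≡y x≢y
  ... | tri≈ _ _ _ = refl
  ... | tri> _ x≢y _ = contradiction x≡y x≢y

  byKey-irr : ∀ x → byKey x x ≡ false
  byKey-irr x = byKey-≡ refl

  byKey-asym : ∀ x y → byKey x y ≡ true → byKey y x ≡ false
  byKey-asym x y xy with <-cmp (key x) (key y)
  ... | tri< x<y _ _ = trans (byKey-> x<y) (cong not xy)
  ... | tri≈ _ _ _ = contradiction xy λ ()
  ... | tri> _ _ y<x = trans (byKey-< y<x) (not-injective xy)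

  byKey-total : ∀ x y → key x ≢ key y → byKey x y ≡ true ⊎ byKey y x ≡ true
  byKey-total x y x≢y with <-cmp (key x) (key y)
  ... | tri< x<y _ _ = Sum.map₂ (trans (byKey-> x<y)) (true⊎not (M x y))
  ... | tri≈ _ x≡y _ = contradiction x≡y x≢y
  ... | tri> _ _ y<x = Sum.swap (Sum.map₁ (trans (byKey-< y<x)) (true⊎not (M y x)))

  byKey-hom : (O : Orientation (K n)) (F : Fin n → A) → (∀ u → key (F u) ≡ u) →
              (∀ u v → toℕ u < toℕ v → M (F u) (F v) ≡ dir O u v) →
              ∀ u v → dir O u v ≡ true → byKey (F u) (F v) ≡ true
  byKey-hom O F key-F M-F u v uv with <-cmp u v
  ... | tri< u<v _ _ = trans (byKey-< (keys-< u<v)) (trans (M-F u v u<v) uv)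
    where keys-< = subst₂ (λ a b → toℕ a < toℕ b) (sym (key-F u)) (sym (key-F v))
  ... | tri≈ _ refl _ = contradiction (trans (sym uv) (dir-asym O u u uv)) λ ()
  ... | tri> _ _ v<u = trans (byKey-> (keys-> v<u)) (cong not (trans (M-F v u v<u) (dir-asym O u v uv)))
    where keys-> = subst₂ (λ a b → toℕ a < toℕ b) (sym (key-F v)) (sym (key-F u))

fromUpperTriangle : ∀ {n} → (Fin n → Fin n → Bool) → Orientation (K n)
fromUpperTriangle M = record
  { dir       = byKey
  ; dir-edge  = λ u v uv → ≢⇒K-adj λ { refl → contradiction (trans (sym uv) (byKey-irr u)) λ () }
  ; dir-total = λ u v uv → byKey-total u v (K-adj⇒≢ uv)
  ; dir-asym  = byKey-asym
  }
  where open ByKey id M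

underlying : ∀ {n} {G : Graph n} → Orientation G → OrientedGraph n
underlying {G = G} O = record { arc = dir O ; arc-irr = irr ; arc-asym = dir-asym O }
  where
  irr : ∀ u → dir O u u ≡ false
  irr u with dir O u u in uu
  ... | true = ⊥-elim (adj⇒≢ G (dir-edge O u u uu) refl)
  ... | false = refl

module _ {h n} (f : Fin h → Fin n) (f-inj : Injective _≡_ _≡_ f) (T : OrientedGraph h) where

  private
    preimage : ∀ x → Dec (∃ λ u → f u ≡ x)
    preimage x = any? λ u → f u ≟ x

    arcBetween : ∀ {x y} → Dec (∃ λ u → f u ≡ x) → Dec (∃ λ v → f v ≡ y) → Bool
    arcBetween (yes (u , _)) (yes (v , _)) = arc T u v
    arcBetween (yes _)       (no _)        = false
    arcBetween (no _)        _             = false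

  image : OrientedGraph n
  image = record
    { arc      = λ x y → arcBetween (preimage x) (preimage y)
    ; arc-irr  = irr
    ; arc-asym = asym
    }
    where
    irr : ∀ x → arcBetween (preimage x) (preimage x) ≡ false
    irr x with preimage x
    ... | yes (u , _) = arc-irr T u
    ... | no _ = refl
    asym : ∀ x y → arcBetween (preimage x) (preimage y) ≡ true → arcBetween (preimage y) (preimage x) ≡ false
    asym x y xy with preimage x | preimage y
    ... | yes (u , _) | yes (v , _) = arc-asym T u v xy
    ... | yes _ | no _ = refl
    ... | no _ | yes _ = refl
    ... | no _ | no _ = refl

  image-arc : ∀ {u v} → arc T u v ≡ true → arc image (f u) (f v) ≡ true
  image-arc {u} {v} uv with preimage (f u) | preimage (f v)
  ... | yes (u′ , fu′≡fu) | yes (v′ , fv′≡fv) rewrite f-inj fu′≡fu | f-inj fv′≡fv = uv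
  ... | yes _ | no ∄v = contradiction (v , refl) ∄v
  ... | no ∄u | _ = contradiction (u , refl) ∄u

module _ {n} (T : OrientedGraph n) where

  private
    arcOrNotReverse : Fin n → Fin n → Bool
    arcOrNotReverse u v = arc T u v ∨ not (arc T v u)

  complete : Orientation (K n)
  complete = fromUpperTriangle arcOrNotReverse

  complete-arc : ∀ {u v} → arc T u v ≡ true → dir complete u v ≡ true
  complete-arc {u} {v} uv with <-cmp u v
  ... | tri< _ _ _ = cong (_∨ not (arc T v u)) uv
  ... | tri≈ _ refl _ = contradiction (trans (sym uv) (arc-irr T u)) λ ()
  ... | tri> _ _ _ = cong₂ (λ a b → not (a ∨ not b)) (arc-asym T u v uv) uv

restrict : ∀ {n} (G : Graph n) → Orientation (K n) → Orientation G
restrict G R = record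
  { dir       = λ u v → adj G u v ∧ dir R u v
  ; dir-edge  = λ u v uv → ∧-conicalˡ _ _ uv
  ; dir-total = λ u v uv → Sum.map (cong₂ _∧_ uv) (cong₂ _∧_ (trans (adj-sym G v u) uv))
                                   (dir-total R u v (≢⇒K-adj (adj⇒≢ G uv)))
  ; dir-asym  = λ u v uv → trans (cong (adj G v u ∧_) (dir-asym R u v (∧-conicalʳ _ _ uv))) (∧-zeroʳ _)
  }

Embedding : ∀ {h n} → Graph h → Graph n → Set
Embedding {h} {n} H G =
  Σ (Fin h → Fin n) λ f → Injective _≡_ _≡_ f × (∀ u v → adj H u v ≡ true → adj G (f u) (f v) ≡ true)

Universal-antitone : ∀ {h n m} {H : Graph h} {G : Graph n} → Embedding H G → Universal G m → Universal H m
Universal-antitone {G = G} (f , f-inj , f-adj) (T , universal) = T , λ O →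
  let I = image f f-inj (underlying O)
      (g , g-hom) = universal (restrict G (complete I))
  in g ∘ f , λ u v uv → g-hom (f u) (f v) (cong₂ _∧_ (f-adj u v (dir-edge O u v uv))
                                                      (complete-arc I (image-arc f f-inj (underlying O) uv)))

-- Deciding universality by exhaustive search

funToFin-cong : ∀ {m n} {f g : Fin m → Fin n} → f ≗ g → funToFin f ≡ funToFin g
funToFin-cong {zero} f≗g = refl
funToFin-cong {suc m} f≗g = cong₂ combine (f≗g zero) (funToFin-cong (f≗g ∘ suc))

funToFin-injective : ∀ {m n} {f g : Fin m → Fin n} → funToFin f ≡ funToFin g → f ≗ g
funToFin-injective {f = f} {g} e u =
  trans (sym (finToFun-funToFin f u)) (trans (cong (λ c → finToFun c u) e) (finToFun-funToFin g u))

finToFun-injective : ∀ {m n} {x y : Fin (m ^ n)} → finToFun {m} {n} x ≗ finToFun y → x ≡ y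
finToFun-injective {m} {n} {x} {y} e =
  trans (sym (funToFin-finToFin {n} {m} x)) (trans (funToFin-cong e) (funToFin-finToFin {n} {m} y))

toBool-injective : ∀ {a b} → toBool a ≡ toBool b → a ≡ b
toBool-injective {a} {b} e = trans (sym (fromBool-toBool a)) (trans (cong fromBool e) (fromBool-toBool b))

fromBool-injective : ∀ {a b} → fromBool a ≡ fromBool b → a ≡ b
fromBool-injective {a} {b} e = trans (sym (toBool-fromBool a)) (trans (cong toBool e) (toBool-fromBool b))

Arcs : ℕ → Set
Arcs n = Fin n → Fin n → Bool

_≐_ : ∀ {n} → Arcs n → Arcs n → Set
r ≐ s = ∀ u v → r u v ≡ s u v

decodeArcs : ∀ {n} → Fin ((2 ^ n) ^ n) → Arcs n
decodeArcs c u v = toBool (finToFun (finToFun c u) v)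

encodeArcs : ∀ {n} → Arcs n → Fin ((2 ^ n) ^ n)
encodeArcs r = funToFin λ u → funToFin λ v → fromBool (r u v)

decodeArcs-encodeArcs : ∀ {n} (r : Arcs n) → decodeArcs (encodeArcs r) ≐ r
decodeArcs-encodeArcs r u v = begin
  toBool (finToFun (finToFun (encodeArcs r) u) v)          ≡⟨ cong (λ x → toBool (finToFun x v)) (finToFun-funToFin _ u) ⟩
  toBool (finToFun (funToFin λ v → fromBool (r u v)) v)    ≡⟨ cong toBool (finToFun-funToFin _ v) ⟩
  toBool (fromBool (r u v))                                ≡⟨ toBool-fromBool (r u v) ⟩
  r u v                                                    ∎
  where open ≡-Reasoning

decodeArcs-injective : ∀ {n} {c d : Fin ((2 ^ n) ^ n)} → decodeArcs {n} c ≐ decodeArcs d → c ≡ d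
decodeArcs-injective {n} e = finToFun-injective {2 ^ n} {n} λ u → finToFun-injective {2} {n} λ v →
  toBool-injective (e u v)

≐-sym : ∀ {n} {r s : Arcs n} → r ≐ s → s ≐ r
≐-sym r≐s u v = sym (r≐s u v)

IsOrientation : ∀ {n} → Graph n → Arcs n → Set
IsOrientation G d = (∀ u v → d u v ≡ true → adj G u v ≡ true)
                  × (∀ u v → adj G u v ≡ true → d u v ≡ true ⊎ d v u ≡ true)
                  × (∀ u v → d u v ≡ true → d v u ≡ false)

IsOrientedGraph : ∀ {m} → Arcs m → Set
IsOrientedGraph a = (∀ u → a u u ≡ false) × (∀ u v → a u v ≡ true → a v u ≡ false)

IsArcHom : ∀ {n m} → Arcs n → Arcs m → (Fin n → Fin m) → Set
IsArcHom d a f = ∀ u v → d u v ≡ true → a (f u) (f v) ≡ true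

UniversalArcs : ∀ {n m} → Graph n → Arcs m → Set
UniversalArcs G a = IsOrientedGraph a × ∀ d → IsOrientation G d → ∃ (IsArcHom d a)

module _ {n} {r s : Arcs n} (r≐s : r ≐ s) where

  private
    move : ∀ {u v b} → r u v ≡ b → s u v ≡ b
    move {u} {v} = trans (sym (r≐s u v))

  IsOrientation-resp : ∀ {G} → IsOrientation G r → IsOrientation G s
  IsOrientation-resp (edge , total , asym) =
    (λ u v → edge u v ∘ move′) , (λ u v → Sum.map move move ∘ total u v) , (λ u v → move ∘ asym u v ∘ move′)
    where
    move′ : ∀ {u v b} → s u v ≡ b → r u v ≡ b
    move′ {u} {v} = trans (r≐s u v)

  IsOrientedGraph-resp : IsOrientedGraph r → IsOrientedGraph s
  IsOrientedGraph-resp (irr , asym) = move ∘ irr , λ u v → move ∘ asym u v ∘ trans (r≐s u v)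

IsArcHom-resp : ∀ {n m} {d d′ : Arcs n} {a a′ : Arcs m} {f f′} →
                d′ ≐ d → a ≐ a′ → f ≗ f′ → IsArcHom d a f → IsArcHom d′ a′ f′
IsArcHom-resp {a′ = a′} d′≐d a≐a′ f≗f′ hom u v uv =
  trans (cong₂ a′ (sym (f≗f′ u)) (sym (f≗f′ v))) (trans (sym (a≐a′ _ _)) (hom u v (trans (sym (d′≐d u v)) uv)))

-- Relations and maps are coded by elements of Fin only up to pointwise equality, hence the
-- respect hypotheses.
∃-arcs? : ∀ {n} {P : Arcs n → Set} → (∀ {r s} → r ≐ s → P r → P s) → Decidable P → Dec (∃ P)
∃-arcs? resp P? = map′ (λ (c , p) → decodeArcs c , p)
                       (λ (r , p) → encodeArcs r , resp (≐-sym (decodeArcs-encodeArcs r)) p)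
                       (any? (P? ∘ decodeArcs))

∀-arcs? : ∀ {n} {P : Arcs n → Set} → (∀ {r s} → r ≐ s → P r → P s) → Decidable P → Dec (∀ r → P r)
∀-arcs? resp P? = map′ (λ p r → resp (decodeArcs-encodeArcs r) (p (encodeArcs r)))
                       (λ p → p ∘ decodeArcs)
                       (all? (P? ∘ decodeArcs))

∃-map? : ∀ {n m} {P : (Fin n → Fin m) → Set} → (∀ {f g} → f ≗ g → P f → P g) → Decidable P → Dec (∃ P)
∃-map? resp P? = map′ (λ (c , p) → finToFun c , p)
                      (λ (f , p) → funToFin f , resp (sym ∘ finToFun-funToFin f) p)
                      (any? (P? ∘ finToFun))

IsOrientation? : ∀ {n} (G : Graph n) → Decidable (IsOrientation G)
IsOrientation? G d =
  all? (λ u → all? λ v → (d u v Boolₚ.≟ true) →-dec (adj G u v Boolₚ.≟ true))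
  ×-dec all? (λ u → all? λ v → (adj G u v Boolₚ.≟ true) →-dec ((d u v Boolₚ.≟ true) ⊎-dec (d v u Boolₚ.≟ true)))
  ×-dec all? (λ u → all? λ v → (d u v Boolₚ.≟ true) →-dec (d v u Boolₚ.≟ false))

IsOrientedGraph? : ∀ {m} → Decidable (IsOrientedGraph {m})
IsOrientedGraph? a = all? (λ u → a u u Boolₚ.≟ false)
                     ×-dec all? (λ u → all? λ v → (a u v Boolₚ.≟ true) →-dec (a v u Boolₚ.≟ false))

IsArcHom? : ∀ {n m} (d : Arcs n) (a : Arcs m) → Decidable (IsArcHom d a)
IsArcHom? d a f = all? λ u → all? λ v → (d u v Boolₚ.≟ true) →-dec (a (f u) (f v) Boolₚ.≟ true)

UniversalArcs? : ∀ {n m} (G : Graph n) → Decidable (UniversalArcs {m = m} G)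
UniversalArcs? G a = IsOrientedGraph? a ×-dec ∀-arcs? resp λ d → IsOrientation? G d →-dec ∃-map? hom-resp (IsArcHom? d a)
  where
  hom-resp : ∀ {d f g} → f ≗ g → IsArcHom d a f → IsArcHom d a g
  hom-resp = IsArcHom-resp {a = a} {a′ = a} (λ _ _ → refl) (λ _ _ → refl)
  resp : ∀ {d d′} → d ≐ d′ → (IsOrientation G d → ∃ (IsArcHom d a)) → IsOrientation G d′ → ∃ (IsArcHom d′ a)
  resp d≐d′ homs d′-or =
    let (f , f-hom) = homs (IsOrientation-resp (≐-sym d≐d′) {G} d′-or)
    in f , IsArcHom-resp {a = a} {a′ = a} (≐-sym d≐d′) (λ _ _ → refl) (λ _ → refl) f-hom

Universal? : ∀ {n} (G : Graph n) m → Dec (Universal G m)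
Universal? G m = map′ fromArcs toArcs (∃-arcs? resp (UniversalArcs? G))
  where
  resp : ∀ {a a′} → a ≐ a′ → UniversalArcs G a → UniversalArcs G a′
  resp a≐a′ (oriented , homs) = IsOrientedGraph-resp a≐a′ oriented , λ d d-or →
    let (f , f-hom) = homs d d-or in f , IsArcHom-resp (λ _ _ → refl) a≐a′ (λ _ → refl) f-hom
  fromArcs : ∃ (UniversalArcs G) → Universal G m
  fromArcs (a , (irr , asym) , homs) =
    record { arc = a ; arc-irr = irr ; arc-asym = asym } ,
    λ O → homs (dir O) (dir-edge O , dir-total O , dir-asym O)
  toArcs : Universal G m → ∃ (UniversalArcs G)
  toArcs (T , homs) = arc T , (arc-irr T , arc-asym T) ,
    λ d (edge , total , asym) → homs (record { dir = d ; dir-edge = edge ; dir-total = total ; dir-asym = asym })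

minimal : ∀ {P : ℕ → Set} → Decidable P → ∀ {m} → P m → ∃ λ k → P k × (∀ m → P m → k ≤ m)
minimal {P} P? {m} = <-rec (λ m → P m → ∃ λ k → P k × (∀ m → P m → k ≤ m)) search m
  where
  search : ∀ m → (∀ {k} → k < m → P k → ∃ λ k → P k × (∀ m → P m → k ≤ m)) → P m → ∃ λ k → P k × (∀ m → P m → k ≤ m)
  search m below pm with any? (λ (i : Fin m) → P? (toℕ i))
  ... | yes (i , pi) = below (toℕ<n i) pi
  ... | no none = m , pm , λ k pk → ≮⇒≥ λ k<m → none (fromℕ< k<m , subst P (sym (toℕ-fromℕ< k<m)) pk)

χ-exists : ∀ {n m} (G : Graph n) → Universal G m → ∃ (IsUpperOrientedChromaticNumber G)
χ-exists G = minimal (Universal? G)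

χ-antitone : ∀ {h n k} {H : Graph h} {G : Graph n} → Embedding H G → IsUpperOrientedChromaticNumber G k →
             ∃ λ k′ → IsUpperOrientedChromaticNumber H k′ × k′ ≤ k
χ-antitone {H = H} H↪G (universal , _) =
  let (k′ , χ′) = χ-exists H (Universal-antitone H↪G universal)
  in k′ , χ′ , proj₂ χ′ _ (Universal-antitone H↪G universal)

-- The counting lower bound

^-distribʳ-* : ∀ m n o → (m * n) ^ o ≡ m ^ o * n ^ o
^-distribʳ-* m n zero = refl
^-distribʳ-* m n (suc o) = trans (cong (m * n *_) (^-distribʳ-* m n o)) ([m*n]*[o*p]≡[m*o]*[n*p] m n (m ^ o) (n ^ o))

^-cancelʳ-≤ : ∀ {m o} n .{{_ : NonZero n}} → m ^ n ≤ o ^ n → m ≤ o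
^-cancelʳ-≤ {m} {o} n mⁿ≤oⁿ with m ≤? o
... | yes m≤o = m≤o
... | no m≰o = contradiction mⁿ≤oⁿ (<⇒≱ (^-monoˡ-< n (≰⇒> m≰o)))

fromUpperTriangle-injective : ∀ {n} {M M′ : Arcs n} →
  dir (fromUpperTriangle M) ≐ dir (fromUpperTriangle M′) →
  dir (fromUpperTriangle (flip M)) ≐ dir (fromUpperTriangle (flip M′)) →
  (∀ u → M u u ≡ M′ u u) → M ≐ M′
fromUpperTriangle-injective {M = M} {M′} upper lower diagonal u v with <-cmp u v
... | tri< u<v _ _ = trans (sym (ByKey.byKey-< id M u<v)) (trans (upper u v) (ByKey.byKey-< id M′ u<v))
... | tri≈ _ refl _ = diagonal u
... | tri> _ _ v<u = trans (sym (ByKey.byKey-< id (flip M) v<u)) (trans (lower v u) (ByKey.byKey-< id (flip M′) v<u))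

Universal-K-count : ∀ {w k} → Universal (K w) k → (2 ^ w) ^ w ≤ 2 ^ w * (k ^ w * k ^ w)
Universal-K-count {w} {k} (T , homs) = injective⇒≤ code-injective
  where
  homCode : Orientation (K w) → Fin (k ^ w)
  homCode O = funToFin (proj₁ (homs O))

  homCode-injective : ∀ {O O′} → homCode O ≡ homCode O′ → dir O ≐ dir O′
  homCode-injective {O} {O′} e u v = begin
    dir O u v            ≡⟨ tournament-hom-arc O T (proj₂ (homs O)) u v ⟩
    arc T (f u) (f v)    ≡⟨ cong₂ (arc T) (f≗f′ u) (f≗f′ v) ⟩
    arc T (f′ u) (f′ v)  ≡⟨ tournament-hom-arc O′ T (proj₂ (homs O′)) u v ⟨
    dir O′ u v           ∎
    where
    open ≡-Reasoning
    f = proj₁ (homs O)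
    f′ = proj₁ (homs O′)
    f≗f′ : f ≗ f′
    f≗f′ = funToFin-injective e

  diagonalCode : Arcs w → Fin (2 ^ w)
  diagonalCode M = funToFin λ u → fromBool (M u u)

  code : Fin ((2 ^ w) ^ w) → Fin (2 ^ w * (k ^ w * k ^ w))
  code c = combine (diagonalCode M) (combine (homCode (fromUpperTriangle M)) (homCode (fromUpperTriangle (flip M))))
    where M = decodeArcs c

  code-injective : Injective _≡_ _≡_ code
  code-injective {c} {c′} e with combine-injective _ _ _ _ e
  ... | diagonal , rest with combine-injective _ _ _ _ rest
  ...   | upper , lower = decodeArcs-injective {w}
    (fromUpperTriangle-injective (homCode-injective upper) (homCode-injective lower) same-diagonal)
    where
    same-diagonal : ∀ u → decodeArcs c u u ≡ decodeArcs c′ u u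
    same-diagonal u = fromBool-injective (funToFin-injective diagonal u)

Universal-K-lower : ∀ {v k} → Universal (K (suc v)) k → 2 ^ v ≤ k * k
Universal-K-lower {v} {k} universal =
  ^-cancelʳ-≤ (suc v) (*-cancelˡ-≤ (2 ^ suc v) {{m^n≢0 2 (suc v)}} (subst₂ _≤_
    (cong (2 ^ suc v *_) (^-distribʳ-* 2 (2 ^ v) v))
    (cong (2 ^ suc v *_) (sym (^-distribʳ-* k k (suc v))))
    (Universal-K-count universal)))

-- The cyclic upper bound

half-< : ∀ {x y j} → x ≤ y → suc x + suc y ≤ suc (j + j) → x < j
half-< {x} {y} {j} x≤y bound = ≰⇒> λ j≤x → 1+n≰n (≤-trans (≤-reflexive (cong suc (sym (+-suc j j))))
                                                  (≤-trans (+-mono-≤ (s≤s j≤x) (s≤s (≤-trans j≤x x≤y))) bound))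

bits : ∀ j → Fin (2 ^ j) → ℕ → Bool
bits j x k with k <? j
... | yes k<j = toBool (finToFun x (fromℕ< k<j))
... | no _ = false

encodeBits : ∀ j → (ℕ → Bool) → Fin (2 ^ j)
encodeBits j g = funToFin λ (i : Fin j) → fromBool (g (toℕ i))

bits-encodeBits : ∀ j (g : ℕ → Bool) {k} → k < j → bits j (encodeBits j g) k ≡ g k
bits-encodeBits j g {k} k<j with k <? j
... | yes k<j′ = trans (cong toBool (finToFun-funToFin (λ (i : Fin j) → fromBool (g (toℕ i))) (fromℕ< k<j′)))
                       (trans (toBool-fromBool _) (cong g (toℕ-fromℕ< k<j′)))
... | no k≮j = contradiction k<j k≮j

module Cyclic (n : ℕ) .{{_ : NonZero n}} where

  toℕ-mod : ∀ u → toℕ u mod n ≡ u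
  toℕ-mod u = toℕ-injective (trans (toℕ-fromℕ< _) (m<n⇒m%n≡m (toℕ<n u)))

  +n-mod : ∀ x → (x + n) mod n ≡ x mod n
  +n-mod x = toℕ-injective (trans (toℕ-fromℕ< _) (trans ([m+n]%n≡m%n x n) (sym (toℕ-fromℕ< _))))

  ahead : ℕ → ℕ → ℕ
  ahead x y = y ∸ suc x

  ahead-spec : ∀ {x y} → x < y → x + suc (ahead x y) ≡ y
  ahead-spec {x} {y} x<y = trans (+-suc x (y ∸ suc x)) (m+[n∸m]≡n x<y)

  -- For u < v on the cycle ℤ/n, going round from u one reaches v after 1 + fwdGap u v
  -- steps and, from v, one reaches u after 1 + bwdGap u v steps.
  fwdGap bwdGap : Fin n → Fin n → ℕ
  fwdGap u v = ahead (toℕ u) (toℕ v)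
  bwdGap u v = ahead (toℕ v) (toℕ u + n)

  fwdGap-spec : ∀ {u v} → toℕ u < toℕ v → toℕ u + suc (fwdGap u v) ≡ toℕ v
  fwdGap-spec = ahead-spec

  bwdGap-spec : ∀ {u v} → toℕ u < toℕ v → toℕ v + suc (bwdGap u v) ≡ toℕ u + n
  bwdGap-spec {u} {v} _ = ahead-spec (<-≤-trans (toℕ<n v) (m≤n+m n (toℕ u)))

  gaps-sum : ∀ {u v} → toℕ u < toℕ v → suc (fwdGap u v) + suc (bwdGap u v) ≡ n
  gaps-sum {u} {v} u<v = +-cancelˡ-≡ (toℕ u) _ _ (begin
    toℕ u + (suc (fwdGap u v) + suc (bwdGap u v))  ≡⟨ +-assoc (toℕ u) _ _ ⟨
    toℕ u + suc (fwdGap u v) + suc (bwdGap u v)    ≡⟨ cong (_+ suc (bwdGap u v)) (fwdGap-spec u<v) ⟩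
    toℕ v + suc (bwdGap u v)                       ≡⟨ bwdGap-spec u<v ⟩
    toℕ u + n                                      ∎)
    where open ≡-Reasoning

  shift : Fin n → ℕ → Fin n
  shift u k = (toℕ u + suc k) mod n

  shift-fwdGap : ∀ {u v} → toℕ u < toℕ v → shift u (fwdGap u v) ≡ v
  shift-fwdGap {u} {v} u<v = trans (cong (_mod n) (fwdGap-spec u<v)) (toℕ-mod v)

  shift-bwdGap : ∀ {u v} → toℕ u < toℕ v → shift v (bwdGap u v) ≡ u
  shift-bwdGap {u} {v} u<v = trans (cong (_mod n) (bwdGap-spec u<v)) (trans (+n-mod (toℕ u)) (toℕ-mod u))

  Vertex : Set
  Vertex = Fin n × (ℕ → Bool)

  -- The pair u < v is recorded by the endpoint from which the other lies at most halfway
  -- round the cycle (u on a tie): bit k of a vertex w describes the arc between w and shift w k.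
  recordedArc : Vertex → Vertex → Bool
  recordedArc (u , s) (v , t) with fwdGap u v ≤? bwdGap u v
  ... | yes _ = s (fwdGap u v)
  ... | no _ = not (t (bwdGap u v))

  open ByKey proj₁ recordedArc

  record Budget (b : Fin n → ℕ) : Set where
    field
      fwd : ∀ {u v} → toℕ u < toℕ v → fwdGap u v ≤ bwdGap u v → fwdGap u v < b u
      bwd : ∀ {u v} → toℕ u < toℕ v → bwdGap u v < fwdGap u v → bwdGap u v < b v

  record Storage (b : Fin n → ℕ) (m : ℕ) : Set where
    field
      decode : Fin m → Vertex
      encode : Fin n → (ℕ → Bool) → Fin m
      decode-encode : ∀ u g → ∃ λ σ → decode (encode u g) ≡ (u , σ) × (∀ {k} → k < b u → σ k ≡ g k)

  recordedArc-correct : ∀ {b} → Budget b → (O : Orientation (K n)) (σ : Fin n → ℕ → Bool) →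
                        (∀ u {k} → k < b u → σ u k ≡ dir O u (shift u k)) →
                        ∀ u v → toℕ u < toℕ v → recordedArc (u , σ u) (v , σ v) ≡ dir O u v
  recordedArc-correct budget O σ stores u v u<v with fwdGap u v ≤? bwdGap u v
  ... | yes f≤b = trans (stores u (Budget.fwd budget u<v f≤b)) (cong (dir O u) (shift-fwdGap u<v))
  ... | no f≰b = begin
    not (σ v (bwdGap u v))                ≡⟨ cong not (stores v (Budget.bwd budget u<v (≰⇒> f≰b))) ⟩
    not (dir O v (shift v (bwdGap u v)))  ≡⟨ cong (not ∘ dir O v) (shift-bwdGap u<v) ⟩
    not (dir O v u)                       ≡⟨ not-dir-flip O (<⇒≢ u<v) ⟩
    dir O u v                             ∎
    where open ≡-Reasoning

  Universal-K : ∀ {b m} → Budget b → Storage b m → Universal (K n) m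
  Universal-K {b} {m} budget storage = T , λ O → place O , hom O
    where
    open Storage storage

    T : OrientedGraph m
    T = record
      { arc      = λ x y → byKey (decode x) (decode y)
      ; arc-irr  = byKey-irr ∘ decode
      ; arc-asym = λ x y → byKey-asym (decode x) (decode y)
      }

    place : Orientation (K n) → Fin n → Fin m
    place O u = encode u λ k → dir O u (shift u k)

    hom : ∀ O → IsHom O T (place O)
    hom O u v uv = subst₂ (λ x y → byKey x y ≡ true) (sym (decoded u)) (sym (decoded v))
                          (byKey-hom O (λ u → u , σ u) (λ _ → refl) (recordedArc-correct budget O σ stores) u v uv)
      where
      σ : Fin n → ℕ → Bool
      σ u = proj₁ (decode-encode u _)
      decoded : ∀ u → decode (place O u) ≡ (u , σ u)
      decoded u = proj₁ (proj₂ (decode-encode u _))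
      stores : ∀ u {k} → k < b u → σ u k ≡ dir O u (shift u k)
      stores u = proj₂ (proj₂ (decode-encode u _))

Universal-K-uniform : ∀ n j .{{_ : NonZero n}} → n ≤ suc (j + j) → Universal (K n) (n * 2 ^ j)
Universal-K-uniform n j n≤ = Universal-K budget storage
  where
  open Cyclic n

  budget : Budget (const j)
  budget = record
    { fwd = λ u<v f≤b → half-< f≤b (≤-trans (≤-reflexive (gaps-sum u<v)) n≤)
    ; bwd = λ {u} {v} u<v b<f → half-< (<⇒≤ b<f)
              (≤-trans (≤-reflexive (trans (+-comm (suc (bwdGap u v)) _) (gaps-sum u<v))) n≤)
    }

  storage : Storage (const j) (n * 2 ^ j)
  storage = record
    { decode        = map₂ (bits j) ∘ remQuot (2 ^ j)
    ; encode        = λ u g → combine u (encodeBits j g)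
    ; decode-encode = λ u g → bits j (encodeBits j g) , cong (map₂ (bits j)) (remQuot-combine u _) , bits-encodeBits j g
    }

module _ (i : ℕ) where

  private
    j = suc i
    n = j + j

    -- Ties go to the lower endpoint, so a vertex u ≥ j never records the pair at distance j
    -- and i bits suffice for it.
    budget : Fin n → ℕ
    budget u = [ const j , const i ]′ (splitAt j u)

    ≥j : ∀ {u : Fin n} {u′} → splitAt j u ≡ inj₂ u′ → j ≤ toℕ u
    ≥j {u} {u′} eq = subst (j ≤_) (trans (sym (toℕ-↑ʳ j u′)) (cong toℕ (splitAt⁻¹-↑ʳ eq))) (m≤m+n j (toℕ u′))

    i≤budget : ∀ u → i ≤ budget u
    i≤budget u with splitAt j u
    ... | inj₁ _ = n≤1+n i
    ... | inj₂ _ = ≤-refl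

  Universal-K-even : Universal (K n) (j * 2 ^ j + j * 2 ^ i)
  Universal-K-even = Universal-K evenBudget evenStorage
    where
    open Cyclic n

    evenBudget : Budget budget
    evenBudget = record { fwd = fwd ; bwd = bwd }
      where
      fwd : ∀ {u v} → toℕ u < toℕ v → fwdGap u v ≤ bwdGap u v → fwdGap u v < budget u
      fwd {u} {v} u<v f≤b with splitAt j u in eq
      ... | inj₁ _ = half-< f≤b (≤-trans (≤-reflexive (gaps-sum u<v)) (n≤1+n n))
      ... | inj₂ _ = s≤s⁻¹ (+-cancelˡ-< j (suc (fwdGap u v)) j (begin-strict
        j + suc (fwdGap u v)      ≤⟨ +-monoˡ-≤ (suc (fwdGap u v)) (≥j eq) ⟩
        toℕ u + suc (fwdGap u v)  ≡⟨ fwdGap-spec u<v ⟩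
        toℕ v                     <⟨ toℕ<n v ⟩
        j + j                     ∎))
        where open ≤-Reasoning
      bwd : ∀ {u v} → toℕ u < toℕ v → bwdGap u v < fwdGap u v → bwdGap u v < budget v
      bwd {u} {v} u<v b<f = <-≤-trans (s≤s⁻¹ (half-< b<f (≤-reflexive (cong suc gaps-sum′)))) (i≤budget v)
        where gaps-sum′ = trans (+-comm (suc (bwdGap u v)) _) (gaps-sum u<v)

    decode : Fin (j * 2 ^ j + j * 2 ^ i) → Vertex
    decode x = [ map (_↑ˡ j) (bits j) ∘ remQuot (2 ^ j) , map (j ↑ʳ_) (bits i) ∘ remQuot (2 ^ i) ]′
                 (splitAt (j * 2 ^ j) x)

    encode : Fin n → (ℕ → Bool) → Fin (j * 2 ^ j + j * 2 ^ i)
    encode u g = [ (λ u′ → combine u′ (encodeBits j g) ↑ˡ (j * 2 ^ i))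
                 , (λ u′ → (j * 2 ^ j) ↑ʳ combine u′ (encodeBits i g)) ]′ (splitAt j u)

    decode-encode : ∀ u g → ∃ λ σ → decode (encode u g) ≡ (u , σ) × (∀ {k} → k < budget u → σ k ≡ g k)
    decode-encode u g with splitAt j u in eq
    ... | inj₁ u′ = bits j (encodeBits j g) , (begin
      decode (combine u′ (encodeBits j g) ↑ˡ (j * 2 ^ i))
        ≡⟨ cong [ _ , _ ]′ (splitAt-↑ˡ (j * 2 ^ j) _ (j * 2 ^ i)) ⟩
      map (_↑ˡ j) (bits j) (remQuot (2 ^ j) (combine u′ (encodeBits j g)))
        ≡⟨ cong (map (_↑ˡ j) (bits j)) (remQuot-combine u′ _) ⟩
      (u′ ↑ˡ j , bits j (encodeBits j g))
        ≡⟨ cong (_, _) (splitAt⁻¹-↑ˡ eq) ⟩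
      (u , bits j (encodeBits j g))  ∎) , bits-encodeBits j g
      where open ≡-Reasoning
    ... | inj₂ u′ = bits i (encodeBits i g) , (begin
      decode ((j * 2 ^ j) ↑ʳ combine u′ (encodeBits i g))
        ≡⟨ cong [ _ , _ ]′ (splitAt-↑ʳ (j * 2 ^ j) (j * 2 ^ i) _) ⟩
      map (j ↑ʳ_) (bits i) (remQuot (2 ^ i) (combine u′ (encodeBits i g)))
        ≡⟨ cong (map (j ↑ʳ_) (bits i)) (remQuot-combine u′ _) ⟩
      (j ↑ʳ u′ , bits i (encodeBits i g))
        ≡⟨ cong (_, _) (splitAt⁻¹-↑ʳ eq) ⟩
      (u , bits i (encodeBits i g))  ∎) , bits-encodeBits i g
      where open ≡-Reasoning

    evenStorage : Storage budget (j * 2 ^ j + j * 2 ^ i)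
    evenStorage = record { decode = decode ; encode = encode ; decode-encode = decode-encode }

spanning : ∀ {n} (G : Graph n) → Embedding G (K n)
spanning G = id , id , λ u v uv → ≢⇒K-adj (adj⇒≢ G uv)

clique-embedding : ∀ {n w} {G : Graph n} → HasClique G w → Embedding (K w) G
clique-embedding (f , f-inj , f-adj) = f , f-inj , λ u v uv → f-adj u v (K-adj⇒≢ uv)

singleton-clique : ∀ {n} (G : Graph (suc n)) → HasClique G 1
singleton-clique G = (λ _ → zero) , (λ { {zero} {zero} _ → refl }) , λ { zero zero 0≢0 → contradiction refl 0≢0 }

χ-K-lower : ∀ {w k} → 1 ≤ w → IsUpperOrientedChromaticNumber (K w) k → 2 ^ (w ∸ 1) ≤ k * k
χ-K-lower {suc _} _ (universal , _) = Universal-K-lower universal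

χ-K-odd : ∀ {n k} → IsUpperOrientedChromaticNumber (K n) k → ∀ j → n ≡ 2 * j + 1 → k ≤ n * 2 ^ j
χ-K-odd (_ , least) j refl =
  least _ (subst (λ n → Universal (K n) (n * 2 ^ j)) (sym (odd j)) (Universal-K-uniform (suc (j + j)) j ≤-refl))
  where
  odd : ∀ j → 2 * j + 1 ≡ suc (j + j)
  odd = solve-∀

χ-K-even : ∀ {n k} → IsUpperOrientedChromaticNumber (K (suc n)) k → ∀ j → suc n ≡ 2 * j → 4 * k ≤ 3 * suc n * 2 ^ j
χ-K-even _ zero ()
χ-K-even {n} {k} (_ , least) (suc i) e = begin
  4 * k                                    ≤⟨ *-monoʳ-≤ 4 (least _ universal) ⟩
  4 * m                                    ≡⟨ size (suc i) (2 ^ i) ⟩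
  3 * (2 * suc i) * 2 ^ suc i              ≡⟨ cong (λ n → 3 * n * 2 ^ suc i) e ⟨
  3 * suc n * 2 ^ suc i                    ∎
  where
  open ≤-Reasoning
  size : ∀ j x → 4 * (j * (2 * x) + j * x) ≡ 3 * (2 * j) * (2 * x)
  size = solve-∀
  m = suc i * 2 ^ suc i + suc i * 2 ^ i
  universal : Universal (K (suc n)) m
  universal = subst (λ n → Universal (K n) m) (trans (cong (suc i +_) (sym (+-identityʳ (suc i)))) (sym e))
                    (Universal-K-even i)

corollary1 : (n : ℕ) → 1 ≤ n → (G : Graph n) → (w : ℕ) → IsCliqueNumber G w →
    Σ ℕ λ kG → Σ ℕ λ kω → Σ ℕ λ kn →
      IsUpperOrientedChromaticNumber G kG ×
      IsUpperOrientedChromaticNumber (K w) kω ×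
      IsUpperOrientedChromaticNumber (K n) kn ×
      kω ≤ kG ×
      2 ^ (w ∸ 1) ≤ kω * kω ×
      kG ≤ kn ×
      (∀ j → n ≡ 2 * j + 1 → kn ≤ n * 2 ^ j) ×
      (∀ j → n ≡ 2 * j → 4 * kn ≤ 3 * n * 2 ^ j)
corollary1 (suc n) _ G w (clique , maximal)
  with χ-exists (K (suc n)) (Universal-K-uniform (suc n) n (s≤s (m≤m+n n n)))
... | kn , χn with χ-antitone (spanning G) χn
... | kG , χG , kG≤kn with χ-antitone (clique-embedding {G = G} clique) χG
... | kω , χω , kω≤kG =
  kG , kω , kn , χG , χω , χn , kω≤kG , χ-K-lower (maximal 1 (singleton-clique G)) χω ,
  kG≤kn , χ-K-odd χn , χ-K-even χn
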